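{- In the setting described in the context, suppose $M_0',M_0''\in\mathcal C$ with $M_0''\subset M_0'$, that $M_1'\subset\Phi_V-M_0'$, and that $f':M_1'\to\mathbb R_{\ge0}$ satisfies $\sum_{\alpha\in M_1'}f'(\alpha)<|M_0'|$ and $n_m\big(\sum_{\alpha\in\Phi_G^+}\alpha-\sum_{\alpha\in M_0'}\alpha+\sum_{\alpha\in M_1'}f'(\alpha)\alpha\big)>0$ for all $m=1,\dots,8$. Suppose there is a function $g:M_0'-M_0''\to M_1'$ such that $\alpha-g(\alpha)\in\Phi_G^+$ for all $\alpha\in M_0'-M_0''$ and $f'(\alpha)-|g^{ -1}(\alpha)|\ge0$ for all $\alpha\in M_1'$. Then for every $M_0\in\mathcal C$ with $M_0''\subset M_0\subset M_0'$ there exist a subset $M_1\subset\Phi_V-M_0$ and a function $f:M_1\to\mathbb R_{\ge0}$ with $\sum_{\alpha\in M_1}f(\alpha)<|M_0|$ and $n_m\big(\sum_{\alpha\in\Phi_G^+}\alpha-\sum_{\alpha\in M_0}\alpha+\sum_{\alpha\in M_1}f(\alpha)\alpha\big)>0$ for all $m=1,\dots,8$.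
   Context: Let $X=\mathbb Q^9/\mathbb Q(1,\dots,1)$ and let $\varepsilon_1,\dots,\varepsilon_9\in X$ be the images of the standard basis vectors (so $\sum_i\varepsilon_i=0$). For $1\le i<j<k\le9$ write $(ijk)=\varepsilon_i+\varepsilon_j+\varepsilon_k$, and let $\Phi_V$ be the set of these 84 elements. Let $\beta_m=\varepsilon_{m+1}-\varepsilon_m$ ($m=1,\dots,8$), a basis of $X$, and let $\Phi_G^+=\{\varepsilon_j-\varepsilon_i:1\le i<j\le9\}$. For $\chi\in X$ let $n_m(\chi)$ be the coefficient of $\beta_m$ when $\chi$ is written in the basis $\beta_1,\dots,\beta_8$. Define a partial order on $X$ by $\alpha\le\gamma$ iff $n_m(\gamma-\alpha)\in\mathbb Z_{\ge0}$ for all $m$. Let $\mathcal C$ be the set of non-empty subsets $M\subset\Phi_V$ that are upward closed: if $\alpha\in M$, $\gamma\in\Phi_V$ and $\alpha\le\gamma$, then $\gamma\in M$.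
   Formalization: The functions f' and f take values in the nonnegative rationals rather than $\mathbb R_{\ge0}$. -}

module Defs where

open import Data.Bool using (Bool; true; false; if_then_else_; _∧_; not)
open import Data.Nat as ℕ using (ℕ; suc)
open import Data.Fin as Fin using (Fin; toℕ)
open import Data.Fin.Subset using (Subset; _∈_; _∉_; _⊆_; ∣_∣; Nonempty)
open import Data.Integer using (+_)
open import Data.Rational as ℚ using (ℚ; 0ℚ; 1ℚ; _+_; _-_; _*_; _<_; _≤_; _/_)
open import Data.List as List using (List; []; _∷_; allFin; concatMap; filter; length; foldr; lookup)
open import Data.Vec as Vec using ()
open import Data.Product using (_×_; _,_; ∃; ∃₂; Σ)
open import Relation.Binary.PropositionalEquality using (_≡_)
open import Relation.Nullary.Decidable using (⌊_⌋)

-- X = ℚ^9 / ℚ(1,…,1).  An element is represented by any vector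
-- Fin 9 → ℚ; two representatives are equal in X iff they differ by a
-- constant vector (_≈X_).

X : Set
X = Fin 9 → ℚ

_+X_ : X → X → X
(x +X y) l = x l + y l

_-X_ : X → X → X
(x -X y) l = x l - y l

_·X_ : ℚ → X → X
(c ·X x) l = c * x l

0X : X
0X _ = 0ℚ

infixl 6 _+X_ _-X_
infixl 7 _·X_

_≈X_ : X → X → Set
x ≈X y = ∃ λ (c : ℚ) → ∀ l → x l ≡ y l + c

-- ε_i (image of the i-th standard basis vector; index i ∈ Fin 9 stands for i+1)
ε : Fin 9 → X
ε i l = if ⌊ i Fin.≟ l ⌋ then 1ℚ else 0ℚ

sumℚ : List ℚ → ℚ
sumℚ = foldr _+_ 0ℚ

sumX : List X → X
sumX = foldr _+X_ 0X

-- n_m(χ): coefficient of β_m = ε_{m+1} - ε_m in the basis β_1..β_8.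
-- With χ represented by (c_1,…,c_9), χ = Σ n_m β_m forces
-- n_m = (m/9)(c_1+…+c_9) - (c_1+…+c_m).  Here m ∈ Fin 8 stands for m+1.
partial : ℕ → X → ℚ
partial k χ = sumℚ (List.map χ (filter (λ l → toℕ l ℕ.<? k) (allFin 9)))

total : X → ℚ
total χ = sumℚ (List.map χ (allFin 9))

nCoef : Fin 8 → X → ℚ
nCoef m χ = ((+ suc (toℕ m)) / 9) * total χ - partial (suc (toℕ m)) χ

_≼_ : X → X → Set
α ≼ γ = ∀ m → ∃ λ (k : ℕ) → nCoef m (γ -X α) ≡ (+ k) / 1

-- Φ_V: the triples i<j<k, enumerated; elements of Φ_V are indexed by Fin N.

Triple : Set
Triple = Fin 9 × Fin 9 × Fin 9

triples : List Triple
triples =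
  concatMap (λ i → concatMap (λ j → List.map (λ k → (i , j , k))
    (filter (λ k → toℕ j ℕ.<? toℕ k) (allFin 9)))
    (filter (λ j → toℕ i ℕ.<? toℕ j) (allFin 9))) (allFin 9)

N : ℕ
N = length triples

root : Fin N → X
root a with lookup triples a
... | (i , j , k) = ε i +X ε j +X ε k

IsPosG : X → Set
IsPosG χ = ∃₂ λ (i j : Fin 9) → (toℕ i ℕ.< toℕ j) × (χ ≈X (ε j -X ε i))

posGsum : X
posGsum = sumX (concatMap (λ i → List.map (λ j → ε j -X ε i)
  (filter (λ j → toℕ i ℕ.<? toℕ j) (allFin 9))) (allFin 9))

mem : Subset N → Fin N → Bool
mem M a = Vec.lookup M a

sumOver : Subset N → (Fin N → ℚ) → ℚ
sumOver M f = sumℚ (List.map (λ a → if mem M a then f a else 0ℚ) (allFin N))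

vsumOver : Subset N → (Fin N → ℚ) → X
vsumOver M f = sumX (List.map (λ a → if mem M a then f a ·X root a else 0X) (allFin N))

UpClosed : Subset N → Set
UpClosed M = ∀ a b → a ∈ M → root a ≼ root b → b ∈ M

InC : Subset N → Set
InC M = Nonempty M × UpClosed M

ℕtoℚ : ℕ → ℚ
ℕtoℚ k = (+ k) / 1

-- M1 ⊂ Φ_V - M0, f : M1 → ℚ_{≥0} (values outside M1 irrelevant),
-- Σ_{M1} f < |M0|, and n_m(Σ_{Φ_G^+} α - Σ_{M0} α + Σ_{M1} f(α)α) > 0 ∀ m.
Good : Subset N → Subset N → (Fin N → ℚ) → Set
Good M0 M1 f =
  (∀ a → a ∈ M1 → a ∉ M0) ×
  (∀ a → a ∈ M1 → 0ℚ ≤ f a) ×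
  (sumOver M1 f < ℕtoℚ ∣ M0 ∣) ×
  (∀ m → 0ℚ < nCoef m (posGsum -X vsumOver M0 (λ _ → 1ℚ) +X vsumOver M1 f))

preimageCount : Subset N → Subset N → (Fin N → Fin N) → Fin N → ℕ
preimageCount M0' M0'' g b =
  length (filter (λ a → Data.Bool._≟_ (mem M0' a ∧ not (mem M0'' a) ∧ ⌊ g a Fin.≟ b ⌋) true) (allFin N))
  where import Data.Bool

{-# OPTIONS --safe #-}
-- Let D = M0' ∖ M0, a subset of M0' ∖ M0''. Keep M1 = M1' and lower the weights to
-- f b = f' b - #{a ∈ D | g a = b}, which stays ≥ 0 because it only removes part of g⁻¹(b).
-- Counting the pairs (a , g a) with a ∈ D both ways gives Σ f = Σ f' - |D| < |M0'| - |D| = |M0|,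
-- and the vector in the positivity condition moves by Σ_{a ∈ D} (a - g a), a sum of positive
-- roots of G. Each n_m is a linear functional on X that is ≥ 0 on positive roots, so every
-- n_m can only increase.
module Submission where

open import Defs
open import Algebra.Bundles using (CommutativeRing)
import Data.Bool as Bool
open import Data.Bool using (Bool; true; false; if_then_else_; _∧_; not)
open import Data.Bool.Properties using (∧-assoc)
open import Data.Fin using (Fin; zero; suc; toℕ; _≟_)
open import Data.Fin.Properties using (all?)
open import Data.Fin.Subset using (Subset; _∈_; _∉_; _⊆_; ∣_∣)
import Data.Integer as ℤ
import Data.Integer.Properties as ℤP
open import Data.List as List using (List; []; _∷_; allFin; filter; length)
open import Data.List.Properties using (map-∘; map-cong)
import Data.Nat as ℕ
import Data.Nat.Coprimality as Coprime
open import Data.Product using (_×_; ∃₂; _,_; proj₁; proj₂)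
open import Data.Rational as ℚ using (ℚ; mkℚ; 0ℚ; 1ℚ; _+_; _*_; _-_; -_; _≤_; _<_)
open import Data.Rational.Properties
  using ( ≤-refl; ≤-reflexive; ≤-trans; +-mono-≤; +-monoˡ-≤; +-monoˡ-<; +-mono-<-≤
        ; +-identityˡ; +-identityʳ; +-inverseʳ; neg-distrib-+; *-identityˡ; *-identityʳ
        ; *-zeroˡ; *-zeroʳ; *-distribˡ-+; nonNegative⁻¹; normalize-coprime
        ; +-*-ring; +-*-commutativeRing; module ≤-Reasoning )
open import Algebra.Properties.Ring +-*-ring using (-1*x≈-x)
open import Algebra.Properties.Semiring.Sum (CommutativeRing.semiring +-*-commutativeRing)
  using (sum; sum-cong-≗; sum-replicate-zero; ∑-distrib-+; ∑-comm; *-distribʳ-sum)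
open import Data.Rational.Solver using (module +-*-Solver)
open +-*-Solver using (solve; _:+_; _:*_; _:-_; _:=_)
import Data.Vec as Vec
import Data.Vec.Properties as VecP
open import Data.Unit using (tt)
open import Function using (_∘_)
open import Relation.Binary.PropositionalEquality
open import Relation.Nullary using (contradiction)
open import Relation.Nullary.Decidable using (⌊_⌋; yes; no; toWitness; _→-dec_)

p≤q⇒0≤q-p : ∀ {p q} → p ≤ q → 0ℚ ≤ q - p
p≤q⇒0≤q-p {p} {q} p≤q = subst (_≤ q - p) (+-inverseʳ p) (+-monoˡ-≤ (- p) p≤q)

p<q+r⇒p-r<q : ∀ {p q r} → p < q + r → p - r < q
p<q+r⇒p-r<q {p} {q} {r} p<q+r =
  subst (p - r <_) (solve 2 (λ q r → (q :+ r) :- r := q) refl q r) (+-monoˡ-< (- r) p<q+r)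

ℕtoℚ-suc : ∀ k → ℕtoℚ (ℕ.suc k) ≡ 1ℚ + ℕtoℚ k
ℕtoℚ-suc k = begin
  (ℤ.+ 1 ℤ.+ ℤ.+ k) ℚ./ 1          ≡⟨ cong (λ z → (ℤ.+ 1 ℤ.+ z) ℚ./ 1) (sym (ℤP.*-identityʳ (ℤ.+ k))) ⟩
  1ℚ + mkℚ (ℤ.+ k) 0 k-coprime-1   ≡⟨ cong (1ℚ +_) (sym (normalize-coprime k-coprime-1)) ⟩
  1ℚ + ℕtoℚ k                      ∎
  where
  open ≡-Reasoning
  k-coprime-1 : Coprime.Coprime k 1
  k-coprime-1 = Coprime.sym (Coprime.1-coprimeTo k)

sum-neg : ∀ {n} (h : Fin n → ℚ) → sum (λ a → - h a) ≡ - sum h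
sum-neg {ℕ.zero}  h = refl
sum-neg {ℕ.suc n} h = trans (cong (- h zero +_) (sum-neg (h ∘ suc)))
                            (sym (neg-distrib-+ (h zero) (sum (h ∘ suc))))

∑-distrib-- : ∀ {n} (h k : Fin n → ℚ) → sum (λ a → h a - k a) ≡ sum h - sum k
∑-distrib-- h k = trans (∑-distrib-+ h (λ a → - k a)) (cong (sum h +_) (sum-neg k))

sum-mono-≤ : ∀ {n} {h k : Fin n → ℚ} → (∀ a → h a ≤ k a) → sum h ≤ sum k
sum-mono-≤ {ℕ.zero}  h≤k = ≤-refl
sum-mono-≤ {ℕ.suc n} h≤k = +-mono-≤ (h≤k zero) (sum-mono-≤ (h≤k ∘ suc))

sum-δ : ∀ {n} (x : Fin n) (h : Fin n → ℚ) → sum (λ b → if ⌊ x ≟ b ⌋ then h b else 0ℚ) ≡ h x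
sum-δ {ℕ.suc n} zero    h = trans (cong (h zero +_) (sum-replicate-zero n)) (+-identityʳ (h zero))
sum-δ {ℕ.suc n} (suc x) h = trans (+-identityˡ _) (trans (sum-cong-≗ shift) (sum-δ x (h ∘ suc)))
  where
  shift : ∀ b → (if ⌊ suc x ≟ suc b ⌋ then h (suc b) else 0ℚ) ≡ (if ⌊ x ≟ b ⌋ then h (suc b) else 0ℚ)
  shift b with x ≟ b
  ... | yes _ = refl
  ... | no  _ = refl

sumℚ-map-tabulate : ∀ {n m} (k : Fin n → Fin m) (h : Fin m → ℚ) →
  sumℚ (List.map h (List.tabulate k)) ≡ sum (h ∘ k)
sumℚ-map-tabulate {ℕ.zero}  k h = refl
sumℚ-map-tabulate {ℕ.suc n} k h = cong (h (k zero) +_) (sumℚ-map-tabulate (k ∘ suc) h)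

sumℚ-map-allFin : ∀ {n} (h : Fin n → ℚ) → sumℚ (List.map h (allFin n)) ≡ sum h
sumℚ-map-allFin = sumℚ-map-tabulate (λ a → a)

module _ {A : Set} where

  sumℚ-map-+ : ∀ (x y : A → ℚ) xs →
    sumℚ (List.map (λ a → x a + y a) xs) ≡ sumℚ (List.map x xs) + sumℚ (List.map y xs)
  sumℚ-map-+ x y []       = sym (+-identityˡ 0ℚ)
  sumℚ-map-+ x y (a ∷ xs) = trans (cong (x a + y a +_) (sumℚ-map-+ x y xs))
    (solve 4 (λ p q r s → (p :+ q) :+ (r :+ s) := (p :+ r) :+ (q :+ s))
           refl (x a) (y a) (sumℚ (List.map x xs)) (sumℚ (List.map y xs)))

  sumℚ-map-*ˡ : ∀ c (x : A → ℚ) xs → sumℚ (List.map (λ a → c * x a) xs) ≡ c * sumℚ (List.map x xs)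
  sumℚ-map-*ˡ c x []       = sym (*-zeroʳ c)
  sumℚ-map-*ˡ c x (a ∷ xs) =
    trans (cong (c * x a +_) (sumℚ-map-*ˡ c x xs)) (sym (*-distribˡ-+ c (x a) (sumℚ (List.map x xs))))

  ℕtoℚ-length-filter : ∀ (P : A → Bool) xs →
    ℕtoℚ (length (filter (λ a → P a Bool.≟ true) xs)) ≡ sumℚ (List.map (λ a → if P a then 1ℚ else 0ℚ) xs)
  ℕtoℚ-length-filter P []       = refl
  ℕtoℚ-length-filter P (x ∷ xs) with P x
  ... | true  = trans (ℕtoℚ-suc (length (filter (λ a → P a Bool.≟ true) xs)))
                      (cong (1ℚ +_) (ℕtoℚ-length-filter P xs))
  ... | false = trans (ℕtoℚ-length-filter P xs) (sym (+-identityˡ _))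

infix 4 _⊆ᵇ_
infixl 5 _∖_

_⊆ᵇ_ : ∀ {n} → (Fin n → Bool) → (Fin n → Bool) → Set
P ⊆ᵇ Q = ∀ a → P a ≡ true → Q a ≡ true

_∖_ : ∀ {n} → (Fin n → Bool) → (Fin n → Bool) → Fin n → Bool
(P ∖ Q) a = P a ∧ not (Q a)

⊆⇒⊆ᵇ : ∀ {n} {M M' : Subset n} → M ⊆ M' → Vec.lookup M ⊆ᵇ Vec.lookup M'
⊆⇒⊆ᵇ {M = M} M⊆M' a Ma = VecP.[]=⇒lookup (M⊆M' (VecP.lookup⇒[]= a M Ma))

∖-true : ∀ {n} (P Q : Fin n → Bool) a → (P ∖ Q) a ≡ true → P a ≡ true × Q a ≡ false
∖-true P Q a with P a | Q a
... | true  | false = λ _ → refl , refl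
... | true  | true  = λ ()
... | false | _     = λ ()

∖-antitoneʳ : ∀ {n} (P : Fin n → Bool) {Q Q' : Fin n → Bool} → Q ⊆ᵇ Q' → P ∖ Q' ⊆ᵇ P ∖ Q
∖-antitoneʳ P {Q} {Q'} Q⊆Q' a P∖Q'a with ∖-true P Q' a P∖Q'a
... | Pa , Q'a with Q a in Qa
...   | false = cong (_∧ true) Pa
...   | true  = contradiction (trans (sym Q'a) (Q⊆Q' a Qa)) λ ()

∖-∈∉ : ∀ {n} {M M' M'' : Subset n} → M'' ⊆ M → ∀ a →
  (Vec.lookup M' ∖ Vec.lookup M) a ≡ true → a ∈ M' × a ∉ M''
∖-∈∉ {M = M} {M'} M''⊆M a a∈M'∖M with ∖-true (Vec.lookup M') (Vec.lookup M) a a∈M'∖M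
... | M'a , Ma = VecP.lookup⇒[]= a M' M'a ,
                 λ a∈M'' → contradiction (trans (sym Ma) (VecP.[]=⇒lookup (M''⊆M a∈M''))) λ ()

restrict : ∀ {n} → (Fin n → Bool) → (Fin n → ℚ) → Fin n → ℚ
restrict P h a = if P a then h a else 0ℚ

count : ∀ {n} → (Fin n → Bool) → ℚ
count P = sum (restrict P (λ _ → 1ℚ))

ℕtoℚ-∣∣ : ∀ {n} (M : Subset n) → ℕtoℚ ∣ M ∣ ≡ count (Vec.lookup M)
ℕtoℚ-∣∣ Vec.[]          = refl
ℕtoℚ-∣∣ (true  Vec.∷ M) = trans (ℕtoℚ-suc ∣ M ∣) (cong (1ℚ +_) (ℕtoℚ-∣∣ M))
ℕtoℚ-∣∣ (false Vec.∷ M) = trans (ℕtoℚ-∣∣ M) (sym (+-identityˡ _))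

restrict-split : ∀ {n} {P Q : Fin n → Bool} → Q ⊆ᵇ P → ∀ h a →
  restrict P h a ≡ restrict Q h a + restrict (P ∖ Q) h a
restrict-split {P = P} {Q} Q⊆P h a with P a in Pa | Q a in Qa
... | true  | true  = sym (+-identityʳ (h a))
... | true  | false = sym (+-identityˡ (h a))
... | false | false = sym (+-identityʳ 0ℚ)
... | false | true  = contradiction (trans (sym Pa) (Q⊆P a Qa)) λ ()

sum-restrict-split : ∀ {n} {P Q : Fin n → Bool} → Q ⊆ᵇ P → ∀ h →
  sum (restrict P h) ≡ sum (restrict Q h) + sum (restrict (P ∖ Q) h)
sum-restrict-split {P = P} {Q} Q⊆P h =
  trans (sum-cong-≗ (restrict-split Q⊆P h)) (∑-distrib-+ (restrict Q h) (restrict (P ∖ Q) h))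

card-split : ∀ {n} {M M' : Subset n} → M ⊆ M' →
  ℕtoℚ ∣ M' ∣ ≡ ℕtoℚ ∣ M ∣ + count (Vec.lookup M' ∖ Vec.lookup M)
card-split {M = M} {M'} M⊆M' = begin
  ℕtoℚ ∣ M' ∣                      ≡⟨ ℕtoℚ-∣∣ M' ⟩
  count (Vec.lookup M')            ≡⟨ sum-restrict-split (⊆⇒⊆ᵇ M⊆M') (λ _ → 1ℚ) ⟩
  count (Vec.lookup M) + count D   ≡⟨ cong (_+ count D) (sym (ℕtoℚ-∣∣ M)) ⟩
  ℕtoℚ ∣ M ∣ + count D             ∎
  where
  open ≡-Reasoning
  D = Vec.lookup M' ∖ Vec.lookup M

sum-restrict-nonneg : ∀ {n} (P : Fin n → Bool) {h : Fin n → ℚ} → (∀ a → P a ≡ true → 0ℚ ≤ h a) →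
  0ℚ ≤ sum (restrict P h)
sum-restrict-nonneg {n} P {h} h≥0 = ≤-trans (≤-reflexive (sym (sum-replicate-zero n))) (sum-mono-≤ pointwise)
  where
  pointwise : ∀ a → 0ℚ ≤ restrict P h a
  pointwise a with P a in Pa
  ... | true  = h≥0 a Pa
  ... | false = ≤-refl

sum-restrict-zero : ∀ {n} (P : Fin n → Bool) → sum (restrict P (λ _ → 0ℚ)) ≡ 0ℚ
sum-restrict-zero {n} P = trans (sum-cong-≗ vanish) (sum-replicate-zero n)
  where
  vanish : ∀ a → restrict P (λ _ → 0ℚ) a ≡ 0ℚ
  vanish a with P a
  ... | true  = refl
  ... | false = refl

count-mono : ∀ {n} {P Q : Fin n → Bool} → P ⊆ᵇ Q → count P ≤ count Q
count-mono {P = P} {Q} P⊆Q = sum-mono-≤ pointwise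
  where
  pointwise : ∀ a → restrict P (λ _ → 1ℚ) a ≤ restrict Q (λ _ → 1ℚ) a
  pointwise a with P a in Pa | Q a in Qa
  ... | false | false = ≤-refl
  ... | false | true  = nonNegative⁻¹ 1ℚ
  ... | true  | true  = ≤-refl
  ... | true  | false = contradiction (trans (sym Qa) (P⊆Q a Pa)) λ ()

count-*ʳ : ∀ {n} (P : Fin n → Bool) x → count P * x ≡ sum (restrict P (λ _ → x))
count-*ʳ P x = trans (*-distribʳ-sum x (restrict P (λ _ → 1ℚ))) (sum-cong-≗ scale)
  where
  scale : ∀ a → restrict P (λ _ → 1ℚ) a * x ≡ restrict P (λ _ → x) a
  scale a with P a
  ... | true  = *-identityˡ x
  ... | false = *-zeroˡ x

preimages : ∀ {n m} → (Fin n → Bool) → (Fin n → Fin m) → Fin m → ℚ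
preimages D g b = count (λ a → D a ∧ ⌊ g a ≟ b ⌋)

preimages-mono : ∀ {n m} {D D' : Fin n → Bool} → D ⊆ᵇ D' → ∀ (g : Fin n → Fin m) b →
  preimages D g b ≤ preimages D' g b
preimages-mono {D = D} {D'} D⊆D' g b = count-mono ∧-mono
  where
  ∧-mono : (λ a → D a ∧ ⌊ g a ≟ b ⌋) ⊆ᵇ (λ a → D' a ∧ ⌊ g a ≟ b ⌋)
  ∧-mono a h with D a in Da
  ... | true  = trans (cong (_∧ ⌊ g a ≟ b ⌋) (D⊆D' a Da)) h
  ... | false = contradiction h λ ()

sum-preimages : ∀ {n m} {D : Fin n → Bool} {M : Fin m → Bool} (g : Fin n → Fin m) →
  (∀ a → D a ≡ true → M (g a) ≡ true) → ∀ w →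
  sum (restrict M (λ b → preimages D g b * w b)) ≡ sum (restrict D (w ∘ g))
sum-preimages {m = m} {D} {M} g g[D]⊆M w = begin
  sum (restrict M (λ b → preimages D g b * w b)) ≡⟨ sum-cong-≗ expand ⟩
  sum (λ b → sum (λ a → T a b))                  ≡⟨ ∑-comm (λ b a → T a b) ⟩
  sum (λ a → sum (λ b → T a b))                  ≡⟨ sum-cong-≗ collapse ⟩
  sum (restrict D (w ∘ g))                       ∎
  where
  open ≡-Reasoning
  T : _ → Fin m → ℚ
  T a b = restrict (λ a → D a ∧ ⌊ g a ≟ b ⌋) (λ _ → restrict M w b) a

  expand : ∀ b → restrict M (λ b → preimages D g b * w b) b ≡ sum (λ a → T a b)
  expand b with M b
  ... | true  = count-*ʳ (λ a → D a ∧ ⌊ g a ≟ b ⌋) (w b)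
  ... | false = sym (sum-restrict-zero (λ a → D a ∧ ⌊ g a ≟ b ⌋))

  collapse : ∀ a → sum (λ b → T a b) ≡ restrict D (w ∘ g) a
  collapse a with D a in Da
  ... | false = sum-replicate-zero m
  ... | true  = trans (sum-δ (g a) (restrict M w)) (cong (λ x → if x then w (g a) else 0ℚ) (g[D]⊆M a Da))

sum-minus-preimages : ∀ {n m} {D : Fin n → Bool} {M : Fin m → Bool} (g : Fin n → Fin m) →
  (∀ a → D a ≡ true → M (g a) ≡ true) → ∀ (f w : Fin m → ℚ) →
  sum (restrict M (λ b → (f b - preimages D g b) * w b))
    ≡ sum (restrict M (λ b → f b * w b)) - sum (restrict D (w ∘ g))
sum-minus-preimages {m = m} {D} {M} g g[D]⊆M f w = begin
  sum (restrict M (λ b → (f b - c b) * w b)) ≡⟨ sum-cong-≗ distrib ⟩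
  sum (λ b → fw b - cw b)                    ≡⟨ ∑-distrib-- fw cw ⟩
  sum fw - sum cw                            ≡⟨ cong (λ x → sum fw - x) (sum-preimages g g[D]⊆M w) ⟩
  sum fw - sum (restrict D (w ∘ g))          ∎
  where
  open ≡-Reasoning
  c fw cw : Fin m → ℚ
  c  = preimages D g
  fw = restrict M (λ b → f b * w b)
  cw = restrict M (λ b → c b * w b)

  distrib : ∀ b → restrict M (λ b → (f b - c b) * w b) b ≡ fw b - cw b
  distrib b with M b
  ... | true  = solve 3 (λ f c w → (f :- c) :* w := f :* w :- c :* w) refl (f b) (c b) (w b)
  ... | false = sym (+-inverseʳ 0ℚ)

ℕtoℚ-preimageCount : ∀ M0' M0'' g b →
  ℕtoℚ (preimageCount M0' M0'' g b) ≡ preimages (mem M0' ∖ mem M0'') g b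
ℕtoℚ-preimageCount M0' M0'' g b =
  trans (ℕtoℚ-length-filter P (allFin N)) (trans (sumℚ-map-allFin (restrict P (λ _ → 1ℚ))) (sum-cong-≗ reassoc))
  where
  P : Fin N → Bool
  P a = mem M0' a ∧ not (mem M0'' a) ∧ ⌊ g a ≟ b ⌋
  reassoc : ∀ a → restrict P (λ _ → 1ℚ) a
                ≡ restrict (λ a → (mem M0' ∖ mem M0'') a ∧ ⌊ g a ≟ b ⌋) (λ _ → 1ℚ) a
  reassoc a = cong (λ x → if x then 1ℚ else 0ℚ) (sym (∧-assoc (mem M0' a) (not (mem M0'' a)) ⌊ g a ≟ b ⌋))

record IsLinearFunctional (ℓ : X → ℚ) : Set where
  field
    resp-≗  : ∀ {x y} → x ≗ y → ℓ x ≡ ℓ y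
    +-homo  : ∀ x y → ℓ (x +X y) ≡ ℓ x + ℓ y
    ·-homo  : ∀ c x → ℓ (c ·X x) ≡ c * ℓ x
    const≡0 : ∀ c → ℓ (λ _ → c) ≡ 0ℚ

  -X-homo : ∀ x y → ℓ (x -X y) ≡ ℓ x - ℓ y
  -X-homo x y = begin
    ℓ (x -X y)             ≡⟨ resp-≗ (λ l → cong (x l +_) (sym (-1*x≈-x (y l)))) ⟩
    ℓ (x +X (- 1ℚ) ·X y)   ≡⟨ +-homo x ((- 1ℚ) ·X y) ⟩
    ℓ x + ℓ ((- 1ℚ) ·X y)  ≡⟨ cong (ℓ x +_) (trans (·-homo (- 1ℚ) y) (-1*x≈-x (ℓ y))) ⟩
    ℓ x - ℓ y              ∎
    where open ≡-Reasoning

  -X-+X-homo : ∀ x y z → ℓ (x -X y +X z) ≡ ℓ x - ℓ y + ℓ z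
  -X-+X-homo x y z = trans (+-homo (x -X y) z) (cong (_+ ℓ z) (-X-homo x y))

  resp-≈X : ∀ {x y} → x ≈X y → ℓ x ≡ ℓ y
  resp-≈X {x} {y} (c , x≗y+c) = begin
    ℓ x                 ≡⟨ resp-≗ x≗y+c ⟩
    ℓ (y +X (λ _ → c))  ≡⟨ +-homo y (λ _ → c) ⟩
    ℓ y + ℓ (λ _ → c)   ≡⟨ cong (ℓ y +_) (const≡0 c) ⟩
    ℓ y + 0ℚ            ≡⟨ +-identityʳ (ℓ y) ⟩
    ℓ y                 ∎
    where open ≡-Reasoning

  sumX-homo : ∀ xs → ℓ (sumX xs) ≡ sumℚ (List.map ℓ xs)
  sumX-homo []       = const≡0 0ℚ
  sumX-homo (x ∷ xs) = trans (+-homo x (sumX xs)) (cong (ℓ x +_) (sumX-homo xs))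

  vsumOver-homo : ∀ M f → ℓ (vsumOver M f) ≡ sum (restrict (mem M) (λ a → f a * ℓ (root a)))
  vsumOver-homo M f = begin
    ℓ (sumX (List.map term (allFin N)))           ≡⟨ sumX-homo (List.map term (allFin N)) ⟩
    sumℚ (List.map ℓ (List.map term (allFin N)))  ≡⟨ cong sumℚ (map-∘ {g = ℓ} {f = term} (allFin N)) ⟨
    sumℚ (List.map (ℓ ∘ term) (allFin N))         ≡⟨ sumℚ-map-allFin (ℓ ∘ term) ⟩
    sum (ℓ ∘ term)                                ≡⟨ sum-cong-≗ homo-term ⟩
    sum (restrict (mem M) (λ a → f a * ℓ (root a))) ∎
    where
    open ≡-Reasoning
    term : Fin N → X
    term a = if mem M a then f a ·X root a else 0X
    homo-term : ∀ a → ℓ (term a) ≡ restrict (mem M) (λ a → f a * ℓ (root a)) a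
    homo-term a with mem M a
    ... | true  = ·-homo (f a) (root a)
    ... | false = const≡0 0ℚ

nCoef-ones≡0 : ∀ m → nCoef m (λ _ → 1ℚ) ≡ 0ℚ
nCoef-ones≡0 = toWitness {a? = all? {n = 8} λ m → nCoef m (λ _ → 1ℚ) ℚ.≟ 0ℚ} tt

nCoef-linear : ∀ m → IsLinearFunctional (nCoef m)
nCoef-linear m = record { resp-≗ = resp-≗ ; +-homo = +-homo ; ·-homo = ·-homo ; const≡0 = const≡0 }
  where
  k = ℕ.suc (toℕ m)
  q = (ℤ.+ k) ℚ./ 9
  all = allFin 9
  below = filter (λ l → toℕ l ℕ.<? k) all
  combine : ℚ → ℚ → ℚ
  combine t p = q * t - p

  resp-≗ : ∀ {x y} → x ≗ y → nCoef m x ≡ nCoef m y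
  resp-≗ x≗y = cong₂ combine (cong sumℚ (map-cong x≗y all)) (cong sumℚ (map-cong x≗y below))

  +-homo : ∀ x y → nCoef m (x +X y) ≡ nCoef m x + nCoef m y
  +-homo x y = trans (cong₂ combine (sumℚ-map-+ x y all) (sumℚ-map-+ x y below))
    (solve 5 (λ q a b c d → q :* (a :+ b) :- (c :+ d) := (q :* a :- c) :+ (q :* b :- d))
           refl q (total x) (total y) (partial k x) (partial k y))

  ·-homo : ∀ c x → nCoef m (c ·X x) ≡ c * nCoef m x
  ·-homo c x = trans (cong₂ combine (sumℚ-map-*ˡ c x all) (sumℚ-map-*ˡ c x below))
    (solve 4 (λ q c a b → q :* (c :* a) :- c :* b := c :* (q :* a :- b))
           refl q c (total x) (partial k x))

  const≡0 : ∀ c → nCoef m (λ _ → c) ≡ 0ℚ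
  const≡0 c = begin
    nCoef m (λ _ → c)          ≡⟨ resp-≗ (λ _ → sym (*-identityʳ c)) ⟩
    nCoef m (c ·X (λ _ → 1ℚ))  ≡⟨ ·-homo c (λ _ → 1ℚ) ⟩
    c * nCoef m (λ _ → 1ℚ)     ≡⟨ cong (c *_) (nCoef-ones≡0 m) ⟩
    c * 0ℚ                     ≡⟨ *-zeroʳ c ⟩
    0ℚ                         ∎
    where open ≡-Reasoning

-- n_m(ε_j - ε_i) is 1 when i ≤ m < j and 0 otherwise.
nCoef-ε-diff-nonneg : ∀ m i j → toℕ i ℕ.< toℕ j → 0ℚ ≤ nCoef m (ε j -X ε i)
nCoef-ε-diff-nonneg = toWitness {a? = all? λ m → all? λ i → all? λ j →
  (toℕ i ℕ.<? toℕ j) →-dec (0ℚ ℚ.≤? nCoef m (ε j -X ε i))} tt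

nCoef-posG-nonneg : ∀ m {χ} → IsPosG χ → 0ℚ ≤ nCoef m χ
nCoef-posG-nonneg m (i , j , i<j , χ≈εj-εi) =
  ≤-trans (nCoef-ε-diff-nonneg m i j i<j) (≤-reflexive (sym (resp-≈X {y = ε j -X ε i} χ≈εj-εi)))
  where open IsLinearFunctional (nCoef-linear m)

weight : Subset N → Subset N → (Fin N → ℚ) → X
weight M0 M1 f = posGsum -X vsumOver M0 (λ _ → 1ℚ) +X vsumOver M1 f

module Shrink {M0 M0' M1 : Subset N} (M0⊆M0' : M0 ⊆ M0') (g : Fin N → Fin N)
  (g[removed]⊆M1 : ∀ a → (mem M0' ∖ mem M0) a ≡ true → mem M1 (g a) ≡ true) (f' : Fin N → ℚ) where

  removed : Fin N → Bool
  removed = mem M0' ∖ mem M0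

  reduced : Fin N → ℚ
  reduced b = f' b - preimages removed g b

  reduced-nonneg : ∀ {M0''} → M0'' ⊆ M0 → ∀ b → ℕtoℚ (preimageCount M0' M0'' g b) ≤ f' b → 0ℚ ≤ reduced b
  reduced-nonneg {M0''} M0''⊆M0 b preimages≤f' = p≤q⇒0≤q-p (begin
    preimages removed g b               ≤⟨ preimages-mono (∖-antitoneʳ (mem M0') (⊆⇒⊆ᵇ M0''⊆M0)) g b ⟩
    preimages (mem M0' ∖ mem M0'') g b  ≡⟨ ℕtoℚ-preimageCount M0' M0'' g b ⟨
    ℕtoℚ (preimageCount M0' M0'' g b)   ≤⟨ preimages≤f' ⟩
    f' b                                ∎)
    where open ≤-Reasoning

  sumOver-reduced : sumOver M1 reduced ≡ sumOver M1 f' - count removed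
  sumOver-reduced = begin
    sumOver M1 reduced                                         ≡⟨ sumℚ-map-allFin (restrict (mem M1) reduced) ⟩
    sum (restrict (mem M1) reduced)                            ≡⟨ sum-cong-≗ (times-one reduced) ⟩
    sum (restrict (mem M1) (λ b → reduced b * 1ℚ))             ≡⟨ sum-minus-preimages {D = removed} {mem M1} g g[removed]⊆M1 f' (λ _ → 1ℚ) ⟩
    sum (restrict (mem M1) (λ b → f' b * 1ℚ)) - count removed  ≡⟨ cong (_- count removed) (sum-cong-≗ (times-one f')) ⟨
    sum (restrict (mem M1) f') - count removed                 ≡⟨ cong (_- count removed) (sumℚ-map-allFin (restrict (mem M1) f')) ⟨
    sumOver M1 f' - count removed                              ∎
    where
    open ≡-Reasoning
    times-one : ∀ h b → restrict (mem M1) h b ≡ restrict (mem M1) (λ b → h b * 1ℚ) b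
    times-one h b = cong (λ x → if mem M1 b then x else 0ℚ) (sym (*-identityʳ (h b)))

  sumOver-reduced< : sumOver M1 f' < ℕtoℚ ∣ M0' ∣ → sumOver M1 reduced < ℕtoℚ ∣ M0 ∣
  sumOver-reduced< ∑f'<∣M0'∣ = subst (_< ℕtoℚ ∣ M0 ∣) (sym sumOver-reduced)
    (p<q+r⇒p-r<q (subst (sumOver M1 f' <_) (card-split M0⊆M0') ∑f'<∣M0'∣))

  module _ {ℓ : X → ℚ} (linear : IsLinearFunctional ℓ) where
    open IsLinearFunctional linear

    excess : ℚ
    excess = sum (restrict removed (λ a → ℓ (root a -X root (g a))))

    weight-reduced : ℓ (weight M0 M1 reduced) ≡ ℓ (weight M0' M1 f') + excess
    weight-reduced = begin
      ℓ (weight M0 M1 reduced)        ≡⟨ -X-+X-homo posGsum (vsumOver M0 (λ _ → 1ℚ)) (vsumOver M1 reduced) ⟩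
      P - V0 + ℓ (vsumOver M1 reduced) ≡⟨ cong (P - V0 +_) reduced-homo ⟩
      P - V0 + (V1' - B)               ≡⟨ solve 5 (λ P V0 V1 A B → P :- V0 :+ (V1 :- B) := P :- (V0 :+ A) :+ V1 :+ (A :- B))
                                                  refl P V0 V1' A B ⟩
      P - (V0 + A) + V1' + (A - B)     ≡⟨ cong₂ (λ u v → P - u + V1' + v) (sym split-homo) excess-split ⟩
      P - V0' + V1' + excess           ≡⟨ cong (_+ excess) (-X-+X-homo posGsum (vsumOver M0' (λ _ → 1ℚ)) (vsumOver M1 f')) ⟨
      ℓ (weight M0' M1 f') + excess    ∎
      where
      open ≡-Reasoning
      r : Fin N → ℚ
      r a = ℓ (root a)
      P V0 V0' V1' A B : ℚ
      P   = ℓ posGsum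
      V0  = ℓ (vsumOver M0 (λ _ → 1ℚ))
      V0' = ℓ (vsumOver M0' (λ _ → 1ℚ))
      V1' = ℓ (vsumOver M1 f')
      A   = sum (restrict removed (λ a → 1ℚ * r a))
      B   = sum (restrict removed (r ∘ g))

      split-homo : V0' ≡ V0 + A
      split-homo = trans (vsumOver-homo M0' (λ _ → 1ℚ))
        (trans (sum-restrict-split {P = mem M0'} {mem M0} (⊆⇒⊆ᵇ M0⊆M0') (λ a → 1ℚ * r a))
               (cong (_+ A) (sym (vsumOver-homo M0 (λ _ → 1ℚ)))))

      reduced-homo : ℓ (vsumOver M1 reduced) ≡ V1' - B
      reduced-homo = trans (vsumOver-homo M1 reduced)
        (trans (sum-minus-preimages {D = removed} {mem M1} g g[removed]⊆M1 f' r)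
               (cong (_- B) (sym (vsumOver-homo M1 f'))))

      excess-split : A - B ≡ excess
      excess-split = trans (sym (∑-distrib-- (restrict removed (λ a → 1ℚ * r a)) (restrict removed (r ∘ g))))
                           (sum-cong-≗ pointwise)
        where
        pointwise : ∀ a → restrict removed (λ a → 1ℚ * r a) a - restrict removed (r ∘ g) a
                        ≡ restrict removed (λ a → ℓ (root a -X root (g a))) a
        pointwise a with removed a
        ... | true  = trans (cong (_- r (g a)) (*-identityˡ (r a))) (sym (-X-homo (root a) (root (g a))))
        ... | false = +-inverseʳ 0ℚ

  nCoef-weight-reduced-pos : (∀ a → removed a ≡ true → IsPosG (root a -X root (g a))) → ∀ m →
    0ℚ < nCoef m (weight M0' M1 f') → 0ℚ < nCoef m (weight M0 M1 reduced)
  nCoef-weight-reduced-pos removed-descends m old>0 =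
    subst (0ℚ <_) (sym (weight-reduced (nCoef-linear m)))
      (subst (_< nCoef m (weight M0' M1 f') + excess (nCoef-linear m)) (+-identityʳ 0ℚ)
             (+-mono-<-≤ old>0 excess≥0))
    where
    excess≥0 : 0ℚ ≤ excess (nCoef-linear m)
    excess≥0 = sum-restrict-nonneg removed (λ a Da → nCoef-posG-nonneg m (removed-descends a Da))

lemma6p6 : (M0' M0'' M1' : Subset N) (f' : Fin N → ℚ) (g : Fin N → Fin N) →
    InC M0' → InC M0'' → M0'' ⊆ M0' →
    Good M0' M1' f' →
    (∀ a → a ∈ M0' → a ∉ M0'' → (g a ∈ M1') × IsPosG (root a -X root (g a))) →
    (∀ b → b ∈ M1' → ℕtoℚ (preimageCount M0' M0'' g b) ≤ f' b) →
    (M0 : Subset N) → InC M0 → M0'' ⊆ M0 → M0 ⊆ M0' →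
    ∃₂ λ (M1 : Subset N) (f : Fin N → ℚ) → Good M0 M1 f
lemma6p6 M0' M0'' M1' f' g _ _ _ (M1'∩M0'=∅ , _ , ∑f'<∣M0'∣ , old>0) g-spec preimages≤f' M0 _ M0''⊆M0 M0⊆M0' =
  M1' , reduced ,
  (λ a a∈M1' a∈M0 → M1'∩M0'=∅ a a∈M1' (M0⊆M0' a∈M0)) ,
  (λ b b∈M1' → reduced-nonneg M0''⊆M0 b (preimages≤f' b b∈M1')) ,
  sumOver-reduced< ∑f'<∣M0'∣ ,
  (λ m → nCoef-weight-reduced-pos (λ a Da → proj₂ (g-on-removed a Da)) m (old>0 m))
  where
  g-on-removed : ∀ a → (mem M0' ∖ mem M0) a ≡ true → (g a ∈ M1') × IsPosG (root a -X root (g a))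
  g-on-removed a Da = let a∈M0' , a∉M0'' = ∖-∈∉ M0''⊆M0 a Da in g-spec a a∈M0' a∉M0''

  open Shrink {M1 = M1'} M0⊆M0' g (λ a Da → VecP.[]=⇒lookup (proj₁ (g-on-removed a Da))) f'
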